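{- Let $G_1$ and $G_2$ be non-complete graphs on disjoint vertex sets. (1) If $G_1$ or $G_2$ is connected, then $\varsigma_c(G_1\vee G_2)=\min\{|V(G_1)|+\varsigma(G_2),\ |V(G_2)|+\varsigma(G_1),\ \theta(G_1)+\theta(G_2)\}$. (2) If both $G_1$ and $G_2$ are disconnected, then $\varsigma_c(G_1\vee G_2)=\min\{|V(G_1)|+\max\{\varsigma(G_2),1\},\ |V(G_2)|+\max\{\varsigma(G_1),1\},\ \theta(G_1)+\theta(G_2)\}$.
   Context: Graphs are finite, simple, undirected. $G_1\vee G_2$ is the join: the disjoint union plus all edges between $V(G_1)$ and $V(G_2)$. $\varsigma(G)$ is the minimum size of a set $S\subseteq V(G)$ such that every component of $G-S$ is a clique; $\varsigma_c(G)$ is the minimum size of such a set with $G[S]$ additionally connected ($\infty$ if none exists). $\theta(G)$ is the minimum size of a set $S$ with $G-S$ a clique. -}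

module Defs where

open import Data.Nat using (ℕ; _+_; _≤_)
open import Data.Nat.Properties using ()
open import Data.Bool using (Bool; true; false)
open import Data.Fin using (Fin; splitAt)
open import Data.Fin.Subset using (Subset; _∈_; _∉_; ∣_∣; ∁; ⊤)
open import Data.Sum using (_⊎_; inj₁; inj₂)
open import Data.Product using (_×_; ∃; ∃-syntax; _,_)
open import Relation.Binary.PropositionalEquality using (_≡_; _≢_; refl)
open import Relation.Nullary using (¬_)

record Graph (n : ℕ) : Set where
  field
    adj    : Fin n → Fin n → Bool
    sym    : ∀ u v → adj u v ≡ adj v u
    irrefl : ∀ u → adj u u ≡ false

open Graph public

Edge : ∀ {n} → Graph n → Fin n → Fin n → Set
Edge G u v = adj G u v ≡ true

-- Join G₁ ∨ G₂ on vertex set Fin (n₁ + n₂): the first n₁ vertices are V(G₁),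
-- the last n₂ are V(G₂); all edges between the two parts are added.
joinAdj : ∀ {n₁ n₂} → Graph n₁ → Graph n₂ → Fin (n₁ + n₂) → Fin (n₁ + n₂) → Bool
joinAdj {n₁} G₁ G₂ u v with splitAt n₁ u | splitAt n₁ v
... | inj₁ a | inj₁ b = adj G₁ a b
... | inj₂ a | inj₂ b = adj G₂ a b
... | inj₁ _ | inj₂ _ = true
... | inj₂ _ | inj₁ _ = true

joinSym : ∀ {n₁ n₂} (G₁ : Graph n₁) (G₂ : Graph n₂) u v →
          joinAdj G₁ G₂ u v ≡ joinAdj G₁ G₂ v u
joinSym {n₁} G₁ G₂ u v with splitAt n₁ u | splitAt n₁ v
... | inj₁ a | inj₁ b = sym G₁ a b
... | inj₂ a | inj₂ b = sym G₂ a b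
... | inj₁ _ | inj₂ _ = refl
... | inj₂ _ | inj₁ _ = refl

joinIrrefl : ∀ {n₁ n₂} (G₁ : Graph n₁) (G₂ : Graph n₂) u →
             joinAdj G₁ G₂ u u ≡ false
joinIrrefl {n₁} G₁ G₂ u with splitAt n₁ u
... | inj₁ a = irrefl G₁ a
... | inj₂ a = irrefl G₂ a

_∨G_ : ∀ {n₁ n₂} → Graph n₁ → Graph n₂ → Graph (n₁ + n₂)
G₁ ∨G G₂ = record { adj = joinAdj G₁ G₂ ; sym = joinSym G₁ G₂ ; irrefl = joinIrrefl G₁ G₂ }

data Reach {n} (G : Graph n) (W : Subset n) : Fin n → Fin n → Set where
  here : ∀ {u} → u ∈ W → Reach G W u u
  step : ∀ {u v w} → u ∈ W → Edge G u v → Reach G W v w → Reach G W u w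

-- G[W] is connected (vacuous for empty W).
InducedConnected : ∀ {n} → Graph n → Subset n → Set
InducedConnected G W = ∀ u v → u ∈ W → v ∈ W → Reach G W u v

Connected : ∀ {n} → Graph n → Set
Connected {n} G = ∀ u v → Reach G ⊤ u v

Complete : ∀ {n} → Graph n → Set
Complete G = ∀ u v → u ≢ v → Edge G u v

-- Every component of G - S is a clique: any two distinct vertices of G - S
-- lying in the same component of G - S are adjacent.
CliqueSep : ∀ {n} → Graph n → Subset n → Set
CliqueSep G S = ∀ u v → Reach G (∁ S) u v → u ≢ v → Edge G u v

ConnCliqueSep : ∀ {n} → Graph n → Subset n → Set
ConnCliqueSep G S = CliqueSep G S × InducedConnected G S

CliqueDel : ∀ {n} → Graph n → Subset n → Set
CliqueDel G S = ∀ u v → u ∉ S → v ∉ S → u ≢ v → Edge G u v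

IsMinimum : ∀ {n} → (Subset n → Set) → ℕ → Set
IsMinimum P k = (∃[ S ] (P S × ∣ S ∣ ≡ k)) × (∀ S → P S → k ≤ ∣ S ∣)

IsVarsigma IsVarsigmaC IsTheta : ∀ {n} → Graph n → ℕ → Set
IsVarsigma  G = IsMinimum (CliqueSep G)
IsVarsigmaC G = IsMinimum (ConnCliqueSep G)
IsTheta     G = IsMinimum (CliqueDel G)

{-# OPTIONS --safe #-}
module Submission where

-- Split a vertex set S of G₁ ∨ G₂ into S₁ ⊆ V(G₁) and S₂ ⊆ V(G₂). If both parts
-- miss a vertex, the two missing vertices are adjacent and together reach all of
-- (G₁ ∨ G₂) − S, so S is a clique separator iff G₁ − S₁ and G₂ − S₂ are cliques;
-- such an S induces a connected subgraph, as non-completeness makes S₁, S₂ ≠ ∅.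
-- Otherwise S contains a whole side, say V(G₁); then the components of (G₁ ∨ G₂) − S
-- are those of G₂ − S₂, and S induces a connected subgraph iff S₂ ≠ ∅ or G₁ is
-- connected. That condition is automatic when G₁ or G₂ is connected, and forces
-- |S₂| ≥ 1 when G₁ is disconnected.

open import Defs
open import Data.Nat using (ℕ; suc; _+_; _⊓_; _⊔_; _≤_; s≤s; z≤n)
open import Data.Nat.Properties
  using (≤-trans; +-comm; +-monoʳ-≤; +-mono-≤; ⊓-sel; ⊔-lub; m≥n⇒m⊔n≡m; m≤n⇒m⊓o≤n; m≤n⇒o⊓m≤n)
open import Data.Sum using (_⊎_; inj₁; inj₂; [_,_]′; fromInj₁; fromInj₂)
import Data.Sum as Sum
open import Data.Product using (_×_; _,_; proj₁; proj₂; ∃-syntax)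
import Data.Product as Product
open import Data.Product.Function.NonDependent.Propositional using (_×-⇔_)
open import Data.Empty using (⊥-elim)
open import Data.Fin using (Fin; zero; _↑ˡ_; _↑ʳ_; splitAt)
open import Data.Fin.Properties
  using (splitAt-↑ˡ; splitAt-↑ʳ; splitAt⁻¹-↑ˡ; splitAt⁻¹-↑ʳ; ↑ˡ-injective; ↑ʳ-injective; all?; ¬∀⟶∃¬)
open import Data.Fin.Subset using (Subset; _∈_; _∉_; _⊆_; ∁; ⊤; ⁅_⁆; ∣_∣; Nonempty; Empty; inside; outside)
open import Data.Fin.Subset.Properties
  using ( _∈?_; ∈⊤; ⊆⊤; ⊆-antisym; nonempty?; Empty-unique; ∣⊥∣≡0; ∣⊤∣≡n; x∈⁅x⁆; ∣⁅x⁆∣≡1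
        ; x∈p⇒∣p-x∣<∣p∣; x∈∁p⇒x∉p; x∉p⇒x∈∁p; p⊆q⇒∁p⊇∁q)
open import Data.Vec using ([]; _∷_; _++_; lookup; tabulate)
import Data.Vec as Vec
open import Data.Vec.Properties
  using (lookup∘tabulate; tabulate∘lookup; tabulate-cong; lookup-++ˡ; lookup-++ʳ; []=⇒lookup; lookup⇒[]=)
open import Function using (_∘_)
open import Function.Bundles using (_⇔_; mk⇔; Equivalence)
open import Relation.Binary.PropositionalEquality as ≡ using (_≡_; refl; subst; cong; cong₂)
open import Relation.Nullary using (¬_; yes; no)

private variable
  m n n₁ n₂ k r₁ r₂ t₁ t₂ : ℕ

∣p++q∣≡∣p∣+∣q∣ : (p : Subset m) (q : Subset n) → ∣ p ++ q ∣ ≡ ∣ p ∣ + ∣ q ∣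
∣p++q∣≡∣p∣+∣q∣ []            q = refl
∣p++q∣≡∣p∣+∣q∣ (inside ∷ p)  q = cong suc (∣p++q∣≡∣p∣+∣q∣ p q)
∣p++q∣≡∣p∣+∣q∣ (outside ∷ p) q = ∣p++q∣≡∣p∣+∣q∣ p q

∣⊤++p∣≡n+∣p∣ : (p : Subset m) → ∣ ⊤ {n} ++ p ∣ ≡ n + ∣ p ∣
∣⊤++p∣≡n+∣p∣ {n = n} p = ≡.trans (∣p++q∣≡∣p∣+∣q∣ (⊤ {n}) p) (cong (_+ ∣ p ∣) (∣⊤∣≡n n))

∣p++⊤∣≡n+∣p∣ : (p : Subset m) → ∣ p ++ ⊤ {n} ∣ ≡ n + ∣ p ∣
∣p++⊤∣≡n+∣p∣ {n = n} p =
  ≡.trans (∣p++q∣≡∣p∣+∣q∣ p (⊤ {n})) (≡.trans (+-comm ∣ p ∣ _) (cong (_+ ∣ p ∣) (∣⊤∣≡n n)))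

nonempty⇒1≤∣p∣ : {p : Subset n} → Nonempty p → 1 ≤ ∣ p ∣
nonempty⇒1≤∣p∣ (_ , x∈p) = ≤-trans (s≤s z≤n) (x∈p⇒∣p-x∣<∣p∣ x∈p)

≡⊤⊎∉ : (p : Subset n) → p ≡ ⊤ ⊎ ∃[ x ] x ∉ p
≡⊤⊎∉ {n} p with all? (_∈? p)
... | yes all∈p = inj₁ (⊆-antisym ⊆⊤ (λ {x} _ → all∈p x))
... | no ¬all∈p = inj₂ (¬∀⟶∃¬ n (_∈ p) (_∈? p) ¬all∈p)

preimage : (Fin m → Fin n) → Subset n → Subset m
preimage f p = tabulate (lookup p ∘ f)

module _ {f : Fin m → Fin n} {p : Subset n} {i : Fin m} where

  ∈-preimage⁺ : f i ∈ p → i ∈ preimage f p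
  ∈-preimage⁺ fi∈p = lookup⇒[]= i _ (≡.trans (lookup∘tabulate (lookup p ∘ f) i) ([]=⇒lookup fi∈p))

  ∈-preimage⁻ : i ∈ preimage f p → f i ∈ p
  ∈-preimage⁻ i∈f⁻¹p = lookup⇒[]= (f i) p
    (≡.trans (≡.sym (lookup∘tabulate (lookup p ∘ f) i)) ([]=⇒lookup i∈f⁻¹p))

  ∈∁-preimage⁺ : f i ∈ ∁ p → i ∈ ∁ (preimage f p)
  ∈∁-preimage⁺ fi∉p = x∉p⇒x∈∁p (x∈∁p⇒x∉p fi∉p ∘ ∈-preimage⁻)

  ∈∁-preimage⁻ : i ∈ ∁ (preimage f p) → f i ∈ ∁ p
  ∈∁-preimage⁻ i∉f⁻¹p = x∉p⇒x∈∁p (x∈∁p⇒x∉p i∉f⁻¹p ∘ ∈-preimage⁺)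

preimage-↑ˡ : (p : Subset m) (q : Subset n) → preimage (_↑ˡ n) (p ++ q) ≡ p
preimage-↑ˡ p q = ≡.trans (tabulate-cong (lookup-++ˡ p q)) (tabulate∘lookup p)

preimage-↑ʳ : (p : Subset m) (q : Subset n) → preimage (m ↑ʳ_) (p ++ q) ≡ q
preimage-↑ʳ p q = ≡.trans (tabulate-cong (lookup-++ʳ p q)) (tabulate∘lookup q)

Attains : (Subset n → Set) → ℕ → Set
Attains P k = ∃[ S ] (P S × ∣ S ∣ ≡ k)

attains-⊓ : {P : Subset n → Set} {a b : ℕ} → Attains P a → Attains P b → Attains P (a ⊓ b)
attains-⊓ {a = a} {b} Pa Pb with ⊓-sel a b
... | inj₁ a⊓b≡a = subst (Attains _) (≡.sym a⊓b≡a) Pa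
... | inj₂ a⊓b≡b = subst (Attains _) (≡.sym a⊓b≡b) Pb

isMinimum-⊓³ : {P : Subset n → Set} {a b c : ℕ} →
  Attains P a → Attains P b → Attains P c →
  (∀ S → P S → a ≤ ∣ S ∣ ⊎ b ≤ ∣ S ∣ ⊎ c ≤ ∣ S ∣) → IsMinimum P (a ⊓ b ⊓ c)
isMinimum-⊓³ {a = a} {b} {c} Pa Pb Pc bound =
  attains-⊓ (attains-⊓ Pa Pb) Pc ,
  λ S PS → [ m≤n⇒m⊓o≤n c ∘ m≤n⇒m⊓o≤n b
           , [ m≤n⇒m⊓o≤n c ∘ m≤n⇒o⊓m≤n a , m≤n⇒o⊓m≤n (a ⊓ b) ]′ ]′ (bound S PS)

isMinimum-cong : {P Q : Subset n → Set} →
  (∀ {S} → P S → Q S) → (∀ {S} → Q S → P S) → IsMinimum P k → IsMinimum Q k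
isMinimum-cong P⇒Q Q⇒P ((S , PS , ∣S∣≡k) , least) = (S , P⇒Q PS , ∣S∣≡k) , λ T → least T ∘ Q⇒P

isMinimum-nonempty : {P : Subset n → Set} → Fin n → (∀ {S T} → S ⊆ T → P S → P T) →
  IsMinimum P k → IsMinimum (λ S → P S × Nonempty S) (k ⊔ 1)
isMinimum-nonempty {n} {k} {P} v P-mono ((S , PS , ∣S∣≡k) , least) =
  attains , λ T (PT , T≢∅) → ⊔-lub (least T PT) (nonempty⇒1≤∣p∣ T≢∅)
  where
  attains : Attains (λ S → P S × Nonempty S) (k ⊔ 1)
  attains with nonempty? S
  ... | yes S≢∅ = S , (PS , S≢∅) ,
                  ≡.trans ∣S∣≡k (≡.sym (m≥n⇒m⊔n≡m (subst (1 ≤_) ∣S∣≡k (nonempty⇒1≤∣p∣ S≢∅))))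
  ... | no  S≡∅ = ⁅ v ⁆ , (P-mono (λ x∈S → ⊥-elim (S≡∅ (_ , x∈S))) PS , v , x∈⁅x⁆ v) ,
                  ≡.trans (∣⁅x⁆∣≡1 v) (cong (_⊔ 1) (≡.sym k≡0))
    where
    k≡0 : k ≡ 0
    k≡0 = ≡.trans (≡.sym ∣S∣≡k) (≡.trans (cong ∣_∣ (Empty-unique S≡∅)) (∣⊥∣≡0 n))

private variable
  G H : Graph n
  G₁ : Graph n₁
  G₂ : Graph n₂
  S T W W′ : Subset n
  u v : Fin n

reach-endpoints : Reach G W u v → u ∈ W × v ∈ W
reach-endpoints (here u∈W)     = u∈W , u∈W
reach-endpoints (step u∈W _ r) = u∈W , proj₂ (reach-endpoints r)

reach-mono : W ⊆ W′ → Reach G W u v → Reach G W′ u v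
reach-mono W⊆W′ (here u∈W)     = here (W⊆W′ u∈W)
reach-mono W⊆W′ (step u∈W e r) = step (W⊆W′ u∈W) e (reach-mono W⊆W′ r)

cliqueDel⇒cliqueSep : CliqueDel G S → CliqueSep G S
cliqueDel⇒cliqueSep del u v r =
  del u v (x∈∁p⇒x∉p (proj₁ (reach-endpoints r))) (x∈∁p⇒x∉p (proj₂ (reach-endpoints r)))

cliqueSep-mono : S ⊆ T → CliqueSep G S → CliqueSep G T
cliqueSep-mono S⊆T sep u v r = sep u v (reach-mono (p⊆q⇒∁p⊇∁q S⊆T) r)

¬complete⇒vertex : ∀ {n} {G : Graph n} → ¬ Complete G → Fin n
¬complete⇒vertex {0}     ¬complete = ⊥-elim (¬complete (λ ()))
¬complete⇒vertex {suc _} _         = zero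

cliqueDel-nonempty : ¬ Complete G → CliqueDel G S → Nonempty S
cliqueDel-nonempty {S = S} ¬complete del with nonempty? S
... | yes S≢∅ = S≢∅
... | no  S≡∅ = ⊥-elim (¬complete λ u v → del u v (S≡∅ ∘ (u ,_)) (S≡∅ ∘ (v ,_)))

cliqueSep-nonempty : Connected G → ¬ Complete G → CliqueSep G S → Nonempty S
cliqueSep-nonempty {S = S} conn ¬complete sep with nonempty? S
... | yes S≢∅ = S≢∅
... | no  S≡∅ = ⊥-elim (¬complete λ u v →
                  sep u v (reach-mono (λ {x} _ → x∉p⇒x∈∁p (S≡∅ ∘ (x ,_))) (conn u v)))

record _↪_ (G : Graph m) (H : Graph n) : Set where
  field
    to        : Fin m → Fin n
    injective : ∀ {a b} → to a ≡ to b → a ≡ b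
    adj-to    : ∀ a b → adj H (to a) (to b) ≡ adj G a b

  edge⁺ : ∀ {a b} → Edge G a b → Edge H (to a) (to b)
  edge⁺ = ≡.trans (adj-to _ _)

  edge⁻ : ∀ {a b} → Edge H (to a) (to b) → Edge G a b
  edge⁻ = ≡.trans (≡.sym (adj-to _ _))

  reach-embed : ∀ {T a b} → (∀ {a} → a ∈ T → to a ∈ W) → Reach G T a b → Reach H W (to a) (to b)
  reach-embed T⇒W (here a∈T)     = here (T⇒W a∈T)
  reach-embed T⇒W (step a∈T e r) = step (T⇒W a∈T) (edge⁺ e) (reach-embed T⇒W r)

  reach-restrict : ∀ {T a b} → (∀ {u} → u ∈ W → ∃[ c ] to c ≡ u) → (∀ {c} → to c ∈ W → c ∈ T) →
                   Reach H W u v → u ≡ to a → v ≡ to b → Reach G T a b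
  reach-restrict _ W⇒T (here u∈W) refl u≡b = subst (Reach G _ _) (injective u≡b) (here (W⇒T u∈W))
  reach-restrict inRange W⇒T (step u∈W e r) refl v≡b with inRange (proj₁ (reach-endpoints r))
  ... | c , refl = step (W⇒T u∈W) (edge⁻ e) (reach-restrict inRange W⇒T r refl v≡b)

  cliqueSep-restrict : CliqueSep H S → CliqueSep G (preimage to S)
  cliqueSep-restrict sep a b r a≢b =
    edge⁻ (sep (to a) (to b) (reach-embed ∈∁-preimage⁻ r) (a≢b ∘ injective))

  cliqueSep-extend : (∀ {u} → u ∉ S → ∃[ a ] to a ≡ u) → CliqueSep G (preimage to S) → CliqueSep H S
  cliqueSep-extend inRange sep u v r u≢v
    with inRange (x∈∁p⇒x∉p (proj₁ (reach-endpoints r))) | inRange (x∈∁p⇒x∉p (proj₂ (reach-endpoints r)))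
  ... | a , refl | b , refl =
    edge⁺ (sep a b (reach-restrict (inRange ∘ x∈∁p⇒x∉p) ∈∁-preimage⁺ r refl refl) (u≢v ∘ cong to))

  inducedConnected-restrict : (∀ {u} → u ∈ S → ∃[ a ] to a ≡ u) →
    InducedConnected H S → InducedConnected G (preimage to S)
  inducedConnected-restrict inRange conn a b a∈ b∈ =
    reach-restrict inRange ∈-preimage⁺ (conn (to a) (to b) (∈-preimage⁻ a∈) (∈-preimage⁻ b∈)) refl refl

  inducedConnected-extend : (∀ {u} → u ∈ S → ∃[ a ] to a ≡ u) →
    InducedConnected G (preimage to S) → InducedConnected H S
  inducedConnected-extend inRange conn u v u∈S v∈S with inRange u∈S | inRange v∈S
  ... | a , refl | b , refl = reach-embed ∈-preimage⁻ (conn a b (∈-preimage⁺ u∈S) (∈-preimage⁺ v∈S))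

open _↪_ using (to)

record IsJoin (H : Graph n) (G₁ : Graph n₁) (G₂ : Graph n₂) : Set where
  field
    left  : G₁ ↪ H
    right : G₂ ↪ H
    cross : ∀ a b → Edge H (to left a) (to right b)
    cover : ∀ u → (∃[ a ] to left a ≡ u) ⊎ (∃[ b ] to right b ≡ u)

  ι₁ : Fin n₁ → Fin n
  ι₁ = to left

  ι₂ : Fin n₂ → Fin n
  ι₂ = to right

  cross′ : ∀ b a → Edge H (ι₂ b) (ι₁ a)
  cross′ b a = ≡.trans (sym H _ _) (cross a b)

  swap : IsJoin H G₂ G₁
  swap = record { left = right ; right = left ; cross = cross′ ; cover = Sum.swap ∘ cover }

-- V(G₁) ∪ T is a connected clique separator of G₁ ∨ G₂ exactly for these T;
-- their minimum size is ς(G₂) or max{ς(G₂), 1}.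
SideSep : Graph n₁ → Graph n₂ → Subset n₂ → Set
SideSep G₁ G₂ T = CliqueSep G₂ T × (Nonempty T ⊎ Connected G₁)

module _ (J : IsJoin H G₁ G₂) where
  open IsJoin J

  -- Any two vertices of G₁ outside S are joined through b in H − S.
  cliqueSep⇒cliqueDel : ∀ {b} → CliqueSep H S → b ∉ preimage ι₂ S → CliqueDel G₁ (preimage ι₁ S)
  cliqueSep⇒cliqueDel {S = S} sep b∉ x y x∉ y∉ x≢y =
    _↪_.edge⁻ left (sep (ι₁ x) (ι₁ y) walk (x≢y ∘ _↪_.injective left))
    where
    walk : Reach H (∁ S) (ι₁ x) (ι₁ y)
    walk = step (∈∁-preimage⁻ (x∉p⇒x∈∁p x∉)) (cross x _)
             (step (∈∁-preimage⁻ (x∉p⇒x∈∁p b∉)) (cross′ _ y) (here (∈∁-preimage⁻ (x∉p⇒x∈∁p y∉))))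

module Join (J : IsJoin H G₁ G₂) where
  open IsJoin J

  cliqueDel-join : CliqueDel G₁ (preimage ι₁ S) → CliqueDel G₂ (preimage ι₂ S) → CliqueDel H S
  cliqueDel-join del₁ del₂ u v u∉S v∉S u≢v with cover u | cover v
  ... | inj₁ (a , refl) | inj₁ (b , refl) =
    _↪_.edge⁺ left (del₁ a b (u∉S ∘ ∈-preimage⁻) (v∉S ∘ ∈-preimage⁻) (u≢v ∘ cong ι₁))
  ... | inj₁ (a , refl) | inj₂ (b , refl) = cross a b
  ... | inj₂ (a , refl) | inj₁ (b , refl) = cross′ a b
  ... | inj₂ (a , refl) | inj₂ (b , refl) =
    _↪_.edge⁺ right (del₂ a b (u∉S ∘ ∈-preimage⁻) (v∉S ∘ ∈-preimage⁻) (u≢v ∘ cong ι₂))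

  inducedConnected-join : Nonempty (preimage ι₁ S) → Nonempty (preimage ι₂ S) → InducedConnected H S
  inducedConnected-join (c₁ , c₁∈) (c₂ , c₂∈) u v u∈S v∈S with cover u | cover v
  ... | inj₁ (a , refl) | inj₁ (b , refl) =
    step u∈S (cross a c₂) (step (∈-preimage⁻ c₂∈) (cross′ c₂ b) (here v∈S))
  ... | inj₁ (a , refl) | inj₂ (b , refl) = step u∈S (cross a b) (here v∈S)
  ... | inj₂ (a , refl) | inj₁ (b , refl) = step u∈S (cross′ a b) (here v∈S)
  ... | inj₂ (a , refl) | inj₂ (b , refl) =
    step u∈S (cross′ a c₁) (step (∈-preimage⁻ c₁∈) (cross c₁ b) (here v∈S))

  connCliqueSep-join : ¬ Complete G₁ → ¬ Complete G₂ →
    CliqueDel G₁ (preimage ι₁ S) → CliqueDel G₂ (preimage ι₂ S) → ConnCliqueSep H S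
  connCliqueSep-join ¬complete₁ ¬complete₂ del₁ del₂ =
    cliqueDel⇒cliqueSep (cliqueDel-join del₁ del₂) ,
    inducedConnected-join (cliqueDel-nonempty {G = G₁} ¬complete₁ del₁)
                          (cliqueDel-nonempty {G = G₂} ¬complete₂ del₂)

  cliqueSep-cases : CliqueSep H S →
    preimage ι₁ S ≡ ⊤ ⊎ preimage ι₂ S ≡ ⊤ ⊎ (CliqueDel G₁ (preimage ι₁ S) × CliqueDel G₂ (preimage ι₂ S))
  cliqueSep-cases {S = S} sep with ≡⊤⊎∉ (preimage ι₁ S) | ≡⊤⊎∉ (preimage ι₂ S)
  ... | inj₁ full₁      | _               = inj₁ full₁
  ... | inj₂ _          | inj₁ full₂      = inj₂ (inj₁ full₂)
  ... | inj₂ (_ , a∉)   | inj₂ (_ , b∉)   =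
    inj₂ (inj₂ (cliqueSep⇒cliqueDel J sep b∉ , cliqueSep⇒cliqueDel swap sep a∉))

  ∈⇒left : Empty (preimage ι₂ S) → u ∈ S → ∃[ a ] ι₁ a ≡ u
  ∈⇒left {u = u} S₂≡∅ u∈S with cover u
  ... | inj₁ ι₁a≡u      = ι₁a≡u
  ... | inj₂ (b , refl) = ⊥-elim (S₂≡∅ (b , ∈-preimage⁺ u∈S))

  module _ (full : preimage ι₁ S ≡ ⊤) where

    ι₁∈ : ∀ a → ι₁ a ∈ S
    ι₁∈ a = ∈-preimage⁻ (subst (a ∈_) (≡.sym full) ∈⊤)

    ∉⇒right : u ∉ S → ∃[ b ] ι₂ b ≡ u
    ∉⇒right {u = u} u∉S with cover u
    ... | inj₁ (a , refl) = ⊥-elim (u∉S (ι₁∈ a))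
    ... | inj₂ ι₂b≡u      = ι₂b≡u

    cliqueSep⇔ : CliqueSep H S ⇔ CliqueSep G₂ (preimage ι₂ S)
    cliqueSep⇔ = mk⇔ (_↪_.cliqueSep-restrict right) (_↪_.cliqueSep-extend right ∉⇒right)

    inducedConnected⇔ : ¬ Complete G₁ → InducedConnected H S ⇔ (Nonempty (preimage ι₂ S) ⊎ Connected G₁)
    inducedConnected⇔ ¬complete₁ = mk⇔ to′ from′
      where
      to′ : InducedConnected H S → Nonempty (preimage ι₂ S) ⊎ Connected G₁
      to′ conn with nonempty? (preimage ι₂ S)
      ... | yes S₂≢∅ = inj₁ S₂≢∅
      ... | no  S₂≡∅ = inj₂ λ a b →
        subst (InducedConnected G₁) full
          (_↪_.inducedConnected-restrict left (∈⇒left S₂≡∅) conn) a b ∈⊤ ∈⊤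
      from′ : Nonempty (preimage ι₂ S) ⊎ Connected G₁ → InducedConnected H S
      from′ S₂≢∅⊎conn with nonempty? (preimage ι₂ S)
      ... | yes S₂≢∅ =
        inducedConnected-join (¬complete⇒vertex {G = G₁} ¬complete₁ , ∈-preimage⁺ (ι₁∈ _)) S₂≢∅
      ... | no  S₂≡∅ =
        _↪_.inducedConnected-extend left (∈⇒left S₂≡∅)
          (subst (InducedConnected G₁) (≡.sym full)
            λ a b _ _ → fromInj₂ (⊥-elim ∘ S₂≡∅) S₂≢∅⊎conn a b)

    connCliqueSep⇔sideSep : ¬ Complete G₁ → ConnCliqueSep H S ⇔ SideSep G₁ G₂ (preimage ι₂ S)
    connCliqueSep⇔sideSep ¬complete₁ = cliqueSep⇔ ×-⇔ inducedConnected⇔ ¬complete₁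

join-isJoin : (G₁ : Graph n₁) (G₂ : Graph n₂) → IsJoin (G₁ ∨G G₂) G₁ G₂
join-isJoin {n₁} {n₂} G₁ G₂ = record
  { left  = record { to = _↑ˡ n₂ ; injective = ↑ˡ-injective n₂ _ _ ; adj-to = adj-↑ˡ }
  ; right = record { to = n₁ ↑ʳ_ ; injective = ↑ʳ-injective n₁ _ _ ; adj-to = adj-↑ʳ }
  ; cross = cross
  ; cover = cover
  }
  where
  adj-↑ˡ : ∀ a b → joinAdj G₁ G₂ (a ↑ˡ n₂) (b ↑ˡ n₂) ≡ adj G₁ a b
  adj-↑ˡ a b rewrite splitAt-↑ˡ n₁ a n₂ | splitAt-↑ˡ n₁ b n₂ = refl
  adj-↑ʳ : ∀ a b → joinAdj G₁ G₂ (n₁ ↑ʳ a) (n₁ ↑ʳ b) ≡ adj G₂ a b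
  adj-↑ʳ a b rewrite splitAt-↑ʳ n₁ n₂ a | splitAt-↑ʳ n₁ n₂ b = refl
  cross : ∀ a b → Edge (G₁ ∨G G₂) (a ↑ˡ n₂) (n₁ ↑ʳ b)
  cross a b rewrite splitAt-↑ˡ n₁ a n₂ | splitAt-↑ʳ n₁ n₂ b = refl
  cover : ∀ u → (∃[ a ] a ↑ˡ n₂ ≡ u) ⊎ (∃[ b ] n₁ ↑ʳ b ≡ u)
  cover u with splitAt n₁ u in eq
  ... | inj₁ a = inj₁ (a , splitAt⁻¹-↑ˡ eq)
  ... | inj₂ b = inj₂ (b , splitAt⁻¹-↑ʳ eq)

module _ {G₁ : Graph n₁} {G₂ : Graph n₂} where
  open Join (join-isJoin G₁ G₂)
  private
    module Swapped = Join (IsJoin.swap (join-isJoin G₁ G₂))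

  connCliqueSep-⊤++ : ¬ Complete G₁ → SideSep G₁ G₂ T → ConnCliqueSep (G₁ ∨G G₂) (⊤ ++ T)
  connCliqueSep-⊤++ {T = T} ¬complete₁ =
    Equivalence.from (connCliqueSep⇔sideSep (preimage-↑ˡ (⊤ {n₁}) T) ¬complete₁)
    ∘ subst (SideSep G₁ G₂) (≡.sym (preimage-↑ʳ (⊤ {n₁}) T))

  connCliqueSep-++⊤ : ¬ Complete G₂ → SideSep G₂ G₁ T → ConnCliqueSep (G₁ ∨G G₂) (T ++ ⊤)
  connCliqueSep-++⊤ {T = T} ¬complete₂ =
    Equivalence.from (Swapped.connCliqueSep⇔sideSep (preimage-↑ʳ T (⊤ {n₂})) ¬complete₂)
    ∘ subst (SideSep G₂ G₁) (≡.sym (preimage-↑ˡ T (⊤ {n₂})))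

  connCliqueSep-++ : ∀ {T₁ T₂} → ¬ Complete G₁ → ¬ Complete G₂ →
    CliqueDel G₁ T₁ → CliqueDel G₂ T₂ → ConnCliqueSep (G₁ ∨G G₂) (T₁ ++ T₂)
  connCliqueSep-++ {T₁ = T₁} {T₂} ¬complete₁ ¬complete₂ del₁ del₂ =
    connCliqueSep-join ¬complete₁ ¬complete₂
      (subst (CliqueDel G₁) (≡.sym (preimage-↑ˡ T₁ T₂)) del₁)
      (subst (CliqueDel G₂) (≡.sym (preimage-↑ʳ T₁ T₂)) del₂)

  connCliqueSep-++-cases : ∀ {S₁ S₂} → ¬ Complete G₁ → ¬ Complete G₂ →
    ConnCliqueSep (G₁ ∨G G₂) (S₁ ++ S₂) →
      (S₁ ≡ ⊤ × SideSep G₁ G₂ S₂) ⊎ (S₂ ≡ ⊤ × SideSep G₂ G₁ S₁) ⊎ (CliqueDel G₁ S₁ × CliqueDel G₂ S₂)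
  connCliqueSep-++-cases {S₁ = S₁} {S₂} ¬complete₁ ¬complete₂ ccs with cliqueSep-cases (proj₁ ccs)
  ... | inj₁ full₁ = inj₁
    ( ≡.trans (≡.sym (preimage-↑ˡ S₁ S₂)) full₁
    , subst (SideSep G₁ G₂) (preimage-↑ʳ S₁ S₂)
        (Equivalence.to (connCliqueSep⇔sideSep full₁ ¬complete₁) ccs))
  ... | inj₂ (inj₁ full₂) = inj₂ (inj₁
    ( ≡.trans (≡.sym (preimage-↑ʳ S₁ S₂)) full₂
    , subst (SideSep G₂ G₁) (preimage-↑ˡ S₁ S₂)
        (Equivalence.to (Swapped.connCliqueSep⇔sideSep full₂ ¬complete₂) ccs)))
  ... | inj₂ (inj₂ (del₁ , del₂)) = inj₂ (inj₂
    ( subst (CliqueDel G₁) (preimage-↑ˡ S₁ S₂) del₁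
    , subst (CliqueDel G₂) (preimage-↑ʳ S₁ S₂) del₂))

  isVarsigmaC-join : ¬ Complete G₁ → ¬ Complete G₂ → IsTheta G₁ t₁ → IsTheta G₂ t₂ →
    IsMinimum (SideSep G₂ G₁) r₁ → IsMinimum (SideSep G₁ G₂) r₂ →
    IsVarsigmaC (G₁ ∨G G₂) ((n₁ + r₂) ⊓ (n₂ + r₁) ⊓ (t₁ + t₂))
  isVarsigmaC-join {t₁ = t₁} {t₂ = t₂} {r₁ = r₁} {r₂ = r₂} ¬complete₁ ¬complete₂
    ((D₁ , del₁ , ∣D₁∣≡t₁) , θ₁-least) ((D₂ , del₂ , ∣D₂∣≡t₂) , θ₂-least)
    ((T₁ , sep₁ , ∣T₁∣≡r₁) , r₁-least) ((T₂ , sep₂ , ∣T₂∣≡r₂) , r₂-least) =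
    isMinimum-⊓³
      (⊤ ++ T₂ , connCliqueSep-⊤++ ¬complete₁ sep₂ , ≡.trans (∣⊤++p∣≡n+∣p∣ T₂) (cong (n₁ +_) ∣T₂∣≡r₂))
      (T₁ ++ ⊤ , connCliqueSep-++⊤ ¬complete₂ sep₁ , ≡.trans (∣p++⊤∣≡n+∣p∣ T₁) (cong (n₂ +_) ∣T₁∣≡r₁))
      (D₁ ++ D₂ , connCliqueSep-++ ¬complete₁ ¬complete₂ del₁ del₂ ,
         ≡.trans (∣p++q∣≡∣p∣+∣q∣ D₁ D₂) (cong₂ _+_ ∣D₁∣≡t₁ ∣D₂∣≡t₂))
      lowerBound
    where
    lowerBound : ∀ S → ConnCliqueSep (G₁ ∨G G₂) S → n₁ + r₂ ≤ ∣ S ∣ ⊎ n₂ + r₁ ≤ ∣ S ∣ ⊎ t₁ + t₂ ≤ ∣ S ∣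
    lowerBound S ccs with Vec.splitAt n₁ S
    ... | S₁ , S₂ , refl with connCliqueSep-++-cases {S₁ = S₁} {S₂} ¬complete₁ ¬complete₂ ccs
    ... | inj₁ (refl , sep) =
      inj₁ (subst (n₁ + r₂ ≤_) (≡.sym (∣⊤++p∣≡n+∣p∣ S₂)) (+-monoʳ-≤ n₁ (r₂-least S₂ sep)))
    ... | inj₂ (inj₁ (refl , sep)) =
      inj₂ (inj₁ (subst (n₂ + r₁ ≤_) (≡.sym (∣p++⊤∣≡n+∣p∣ S₁)) (+-monoʳ-≤ n₂ (r₁-least S₁ sep))))
    ... | inj₂ (inj₂ (del₁ , del₂)) =
      inj₂ (inj₂ (subst (t₁ + t₂ ≤_) (≡.sym (∣p++q∣≡∣p∣+∣q∣ S₁ S₂))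
                   (+-mono-≤ (θ₁-least S₁ del₁) (θ₂-least S₂ del₂))))

sideSep-minimum : ∀ {s} → Connected G₁ ⊎ Connected G₂ → ¬ Complete G₂ →
  IsVarsigma G₂ s → IsMinimum (SideSep G₁ G₂) s
sideSep-minimum {G₁ = G₁} {G₂ = G₂} conn ¬complete₂ =
  isMinimum-cong (λ sep → sep , nonempty⊎connected sep) proj₁
  where
  nonempty⊎connected : ∀ {T} → CliqueSep G₂ T → Nonempty T ⊎ Connected G₁
  nonempty⊎connected sep =
    [ inj₂ , (λ conn₂ → inj₁ (cliqueSep-nonempty {G = G₂} conn₂ ¬complete₂ sep)) ]′ conn

sideSep-minimum-disconnected : ∀ {s} → ¬ Connected G₁ → ¬ Complete G₂ →
  IsVarsigma G₂ s → IsMinimum (SideSep G₁ G₂) (s ⊔ 1)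
sideSep-minimum-disconnected {G₂ = G₂} ¬conn₁ ¬complete₂ =
  isMinimum-cong (Product.map₂ inj₁) (Product.map₂ (fromInj₁ (⊥-elim ∘ ¬conn₁)))
  ∘ isMinimum-nonempty (¬complete⇒vertex {G = G₂} ¬complete₂) (cliqueSep-mono {G = G₂})

lemma26 : ∀ {n₁ n₂} (G₁ : Graph n₁) (G₂ : Graph n₂) →
    ¬ Complete G₁ → ¬ Complete G₂ →
    ∀ (s₁ s₂ t₁ t₂ : ℕ) →
    IsVarsigma G₁ s₁ → IsVarsigma G₂ s₂ → IsTheta G₁ t₁ → IsTheta G₂ t₂ →
    ((Connected G₁ ⊎ Connected G₂) →
       IsVarsigmaC (G₁ ∨G G₂) ((n₁ + s₂) ⊓ (n₂ + s₁) ⊓ (t₁ + t₂)))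
    × ((¬ Connected G₁ × ¬ Connected G₂) →
       IsVarsigmaC (G₁ ∨G G₂) ((n₁ + (s₂ ⊔ 1)) ⊓ (n₂ + (s₁ ⊔ 1)) ⊓ (t₁ + t₂)))
lemma26 G₁ G₂ ¬complete₁ ¬complete₂ s₁ s₂ t₁ t₂ ς₁ ς₂ θ₁ θ₂ =
    (λ conn → isVarsigmaC-join ¬complete₁ ¬complete₂ θ₁ θ₂
      (sideSep-minimum {G₁ = G₂} (Sum.swap conn) ¬complete₁ ς₁)
      (sideSep-minimum {G₁ = G₁} conn ¬complete₂ ς₂))
  , (λ (¬conn₁ , ¬conn₂) → isVarsigmaC-join ¬complete₁ ¬complete₂ θ₁ θ₂
      (sideSep-minimum-disconnected {G₁ = G₂} ¬conn₂ ¬complete₁ ς₁)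
      (sideSep-minimum-disconnected {G₁ = G₁} ¬conn₁ ¬complete₂ ς₂))
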